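{- Let $k$ be a field of characteristic not $2$, $g\ge1$, and $V$ a $(2g+1)$-dimensional $k$-vector space with a nondegenerate symmetric bilinear form $\psi$. Let $(b_0,\dots,b_{2g})$ be a basis of $V$ such that $\psi(b_i,b_j)=0$ whenever $i+j<2g$. Then there exists a unique basis $(p_0,\dots,p_{2g})$ of $V$ such that: (1) $p_i=b_i$ for $i=0,\dots,g$; (2) $p_{g+i}\in b_{g+i}+\langle b_{g+i-1},\dots,b_{g-i+1},b_{g-i}\rangle$ for $i=1,\dots,g$; (3) $\psi(p_i,p_j)=0$ for all $0\le i,j\le 2g$ with $i+j\ne2g$. -}

module Defs where

open import Level using (Level; _⊔_)
open import Algebra.Bundles using (CommutativeRing)
open import Algebra.Module.Bundles using (Module)
open import Data.Nat using (ℕ; zero; suc)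
import Data.Nat as N
open import Data.Fin using (Fin; toℕ)
open import Data.Fin as F using ()
open import Data.Product using (Σ; _×_; _,_; ∃)
open import Data.Sum using (_⊎_)
open import Relation.Nullary using (¬_)
open import Relation.Binary.PropositionalEquality using (_≢_)

record IsField {c ℓ : Level} (K : CommutativeRing c ℓ) : Set (c ⊔ ℓ) where
  open CommutativeRing K
  field
    1≉0     : ¬ (1# ≈ 0#)
    inverse : ∀ x → ¬ (x ≈ 0#) → Σ Carrier (λ y → (x * y) ≈ 1#)

CharNot2 : {c ℓ : Level} (K : CommutativeRing c ℓ) → Set ℓ
CharNot2 K = ¬ ((1# + 1#) ≈ 0#)
  where open CommutativeRing K

module _ {r ℓr m ℓm : Level} {K : CommutativeRing r ℓr} (V : Module K m ℓm) where
  open CommutativeRing K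
  open Module V

  lincomb : {n : ℕ} → (Fin n → Carrier) → (Fin n → Carrierᴹ) → Carrierᴹ
  lincomb {zero}  c v = 0ᴹ
  lincomb {suc n} c v = (c F.zero *ₗ v F.zero) +ᴹ lincomb (λ i → c (F.suc i)) (λ i → v (F.suc i))

  LinearlyIndependent : {n : ℕ} → (Fin n → Carrierᴹ) → Set (r ⊔ ℓr ⊔ ℓm)
  LinearlyIndependent {n} v = ∀ (c : Fin n → Carrier) → lincomb c v ≈ᴹ 0ᴹ → ∀ i → c i ≈ 0#

  Spanning : {n : ℕ} → (Fin n → Carrierᴹ) → Set (r ⊔ m ⊔ ℓm)
  Spanning {n} v = ∀ (x : Carrierᴹ) → Σ (Fin n → Carrier) (λ c → lincomb c v ≈ᴹ x)

  IsBasis : {n : ℕ} → (Fin n → Carrierᴹ) → Set (r ⊔ ℓr ⊔ m ⊔ ℓm)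
  IsBasis v = LinearlyIndependent v × Spanning v

  record IsSymmetricBilinear (ψ : Carrierᴹ → Carrierᴹ → Carrier) : Set (r ⊔ ℓr ⊔ m ⊔ ℓm) where
    field
      cong   : ∀ {u u′ v v′} → u ≈ᴹ u′ → v ≈ᴹ v′ → ψ u v ≈ ψ u′ v′
      +-left : ∀ u u′ v → ψ (u +ᴹ u′) v ≈ (ψ u v + ψ u′ v)
      *-left : ∀ a u v → ψ (a *ₗ u) v ≈ (a * ψ u v)
      +-right : ∀ u v v′ → ψ u (v +ᴹ v′) ≈ (ψ u v + ψ u v′)
      *-right : ∀ a u v → ψ u (a *ₗ v) ≈ (a * ψ u v)
      symmetric : ∀ u v → ψ u v ≈ ψ v u

  Nondegenerate : (ψ : Carrierᴹ → Carrierᴹ → Carrier) → Set (ℓr ⊔ m ⊔ ℓm)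
  Nondegenerate ψ = ∀ u → (∀ v → ψ u v ≈ 0#) → u ≈ᴹ 0ᴹ

  record Conditions (ψ : Carrierᴹ → Carrierᴹ → Carrier) (g : ℕ)
                    (b p : Fin (suc (2 N.* g)) → Carrierᴹ) : Set (r ⊔ ℓr ⊔ m ⊔ ℓm) where
    field
      cond1 : ∀ i → toℕ i N.≤ g → p i ≈ᴹ b i
      -- (2) for m = g+t (t = 1..g): p_m ∈ b_m + ⟨b_{2g-m}, …, b_{m-1}⟩, i.e.
      --     p_m = b_m + Σ_j c_j b_j with c_j = 0 unless 2g-m ≤ j ≤ m-1
      cond2 : ∀ i → g N.< toℕ i →
              Σ (Fin (suc (2 N.* g)) → Carrier) (λ c →
                 (∀ j → (toℕ j N.+ toℕ i N.< 2 N.* g) ⊎ (toℕ i N.≤ toℕ j) → c j ≈ 0#)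
                 × (p i ≈ᴹ (b i +ᴹ lincomb c b)))
      cond3 : ∀ i j → toℕ i N.+ toℕ j ≢ 2 N.* g → ψ (p i) (p j) ≈ 0#

-- The Gram matrix G i j = ψ (b i) (b j) vanishes above the antidiagonal i + j = 2g,
-- and nondegeneracy forces the antidiagonal entries G i (2g - i) to be nonzero:
-- otherwise triangular elimination of b i against the earlier b j produces a
-- nonzero vector orthogonal to the whole basis.
--
-- For g < t and l = 2g - t, conditions (2) and (3) say that
-- p t = b t + Σ_{l ≤ j < t} c j · b j is orthogonal to b k for l < k < t and
-- isotropic. Because the antidiagonal entries are invertible, the orthogonality
-- equations determine c j for l < j < t one by one from the top down, and then,
-- since b l is isotropic and ψ (p t) (b l) = G t l ≠ 0, the quadratic equation
-- ψ (p t) (p t) = 0 is affine in c l with slope 2 G t l ≠ 0 (char ≠ 2). The Gram matrix of p against the reversed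
-- family p (2g - i) is diagonal with nonzero entries, so p is independent; it
-- spans because b is unitriangular in terms of p.

module Submission where

open import Defs
open import Level using (Level; _⊔_)
open import Algebra.Bundles using (CommutativeRing; CommutativeMonoid)
import Algebra.Properties.CommutativeSemigroup as CommutativeSemigroupProperties
open import Algebra.Module.Bundles using (Module)
open import Data.Nat using (ℕ; zero; suc; z≤n)
import Data.Nat as ℕ
import Data.Nat.Properties as ℕₚ
open import Data.Fin using (Fin; toℕ; fromℕ<; opposite; _≟_) renaming (zero to fzero; suc to fsuc)
import Data.Fin.Properties as Fin
open import Data.Fin.Induction using (<-wellFounded)
open import Induction.WellFounded using (module All)
open import Data.Product using (Σ; Σ-syntax; _×_; _,_; proj₁; proj₂)
open import Data.Sum using (_⊎_; inj₁; inj₂; [_,_]′; map; map₁; map₂)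
open import Relation.Nullary using (¬_; yes; no; contradiction)
open import Relation.Binary.Definitions using (tri<; tri≈; tri>)
open import Relation.Binary.PropositionalEquality as ≡ using (_≡_; _≢_)
open import Function using (_∘_)
import Relation.Binary.Reasoning.Setoid as SetoidReasoning

toℕ-opposite-+ : ∀ {n} (k : Fin (suc n)) → toℕ (opposite k) ℕ.+ toℕ k ≡ n
toℕ-opposite-+ k = ≡.trans (≡.cong (ℕ._+ toℕ k) (Fin.opposite-prop k)) (ℕₚ.m∸n+n≡m (ℕₚ.≤-pred (Fin.toℕ<n k)))

+≡⇒≡opposite : ∀ {n} {j k : Fin (suc n)} → toℕ j ℕ.+ toℕ k ≡ n → j ≡ opposite k
+≡⇒≡opposite {k = k} j+k≡n =
  Fin.toℕ-injective (ℕₚ.+-cancelʳ-≡ (toℕ k) _ _ (≡.trans j+k≡n (≡.sym (toℕ-opposite-+ k))))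

private
  +≡+⇒<⇒> : ∀ {a b c d} → a ℕ.+ b ≡ c ℕ.+ d → b ℕ.< d → c ℕ.< a
  +≡+⇒<⇒> {a} {b} {c} {d} a+b≡c+d b<d = ℕₚ.+-cancelʳ-< d c a (begin-strict
    c ℕ.+ d ≡⟨ ≡.sym a+b≡c+d ⟩
    a ℕ.+ b <⟨ ℕₚ.+-monoʳ-< a b<d ⟩
    a ℕ.+ d ∎)
    where open ℕₚ.≤-Reasoning

opposite<⇒<+ : ∀ {n} {j k : Fin (suc n)} → toℕ (opposite k) ℕ.< toℕ j → n ℕ.< toℕ j ℕ.+ toℕ k
opposite<⇒<+ {n} {j} {k} k′<j = ≡.subst (ℕ._< toℕ j ℕ.+ toℕ k) (toℕ-opposite-+ k) (ℕₚ.+-monoˡ-< (toℕ k) k′<j)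

<+⇒opposite< : ∀ {n} {j k : Fin (suc n)} → n ℕ.< toℕ j ℕ.+ toℕ k → toℕ (opposite k) ℕ.< toℕ j
<+⇒opposite< {n} {j} {k} n<j+k =
  ℕₚ.+-cancelʳ-< (toℕ k) _ _ (≡.subst (ℕ._< toℕ j ℕ.+ toℕ k) (≡.sym (toℕ-opposite-+ k)) n<j+k)

opposite-<-swap : ∀ {n} {i k : Fin (suc n)} → toℕ (opposite i) ℕ.< toℕ k → toℕ (opposite k) ℕ.< toℕ i
opposite-<-swap {n} {i} {k} i′<k = <+⇒opposite< (≡.subst (n ℕ.<_) (ℕₚ.+-comm (toℕ k) (toℕ i)) (opposite<⇒<+ i′<k))

opposite-reverses-< : ∀ {n} {i k : Fin (suc n)} → toℕ i ℕ.< toℕ k → toℕ (opposite k) ℕ.< toℕ (opposite i)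
opposite-reverses-< {i = i} {k} = +≡+⇒<⇒> (≡.trans (toℕ-opposite-+ i) (≡.sym (toℕ-opposite-+ k)))

module FieldProperties {c ℓ : Level} (K : CommutativeRing c ℓ) (isField : IsField K) where
  open CommutativeRing K
  open IsField isField
  open import Algebra.Properties.Ring ring using (-‿distribˡ-*)
  open SetoidReasoning setoid

  x*y≈0⇒x≈0 : ∀ {x y} → ¬ y ≈ 0# → x * y ≈ 0# → x ≈ 0#
  x*y≈0⇒x≈0 {x} {y} y≉0 xy≈0 = begin
    x              ≈⟨ *-identityʳ x ⟨
    x * 1#         ≈⟨ *-congˡ (proj₂ (inverse y y≉0)) ⟨
    x * (y * y⁻¹)  ≈⟨ *-assoc x y y⁻¹ ⟨
    (x * y) * y⁻¹  ≈⟨ *-congʳ xy≈0 ⟩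
    0# * y⁻¹       ≈⟨ zeroˡ y⁻¹ ⟩
    0#             ∎
    where y⁻¹ = proj₁ (inverse y y≉0)

  solve-linear : ∀ {a} → ¬ a ≈ 0# → ∀ x → Σ[ s ∈ Carrier ] x + s * a ≈ 0#
  solve-linear {a} a≉0 x = - (x * a⁻¹) , (begin
    x + - (x * a⁻¹) * a   ≈⟨ +-congˡ (-‿distribˡ-* (x * a⁻¹) a) ⟨
    x + - (x * a⁻¹ * a)   ≈⟨ +-congˡ (-‿cong (*-assoc x a⁻¹ a)) ⟩
    x + - (x * (a⁻¹ * a)) ≈⟨ +-congˡ (-‿cong (*-congˡ (trans (*-comm a⁻¹ a) aa⁻¹≈1))) ⟩
    x + - (x * 1#)        ≈⟨ +-congˡ (-‿cong (*-identityʳ x)) ⟩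
    x + - x               ≈⟨ -‿inverseʳ x ⟩
    0#                    ∎)
    where a⁻¹ = proj₁ (inverse a a≉0)
          aa⁻¹≈1 = proj₂ (inverse a a≉0)

module LinearCombinations {r ℓr m ℓm : Level} {K : CommutativeRing r ℓr} (V : Module K m ℓm) where
  open CommutativeRing K
  open Module V
  open SetoidReasoning ≈ᴹ-setoid

  lincomb-cong : ∀ {n} {c d : Fin n → Carrier} (v : Fin n → Carrierᴹ) →
                 (∀ i → c i ≈ d i) → lincomb V c v ≈ᴹ lincomb V d v
  lincomb-cong {zero}  v c≈d = ≈ᴹ-refl
  lincomb-cong {suc n} v c≈d =
    +ᴹ-cong (*ₗ-cong (c≈d fzero) ≈ᴹ-refl) (lincomb-cong (λ i → v (fsuc i)) (λ i → c≈d (fsuc i)))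

  lincomb-zero : ∀ {n} {c : Fin n → Carrier} (v : Fin n → Carrierᴹ) →
                 (∀ i → c i ≈ 0#) → lincomb V c v ≈ᴹ 0ᴹ
  lincomb-zero {zero}  v c≈0 = ≈ᴹ-refl
  lincomb-zero {suc n} v c≈0 =
    ≈ᴹ-trans (+ᴹ-cong (≈ᴹ-trans (*ₗ-cong (c≈0 fzero) ≈ᴹ-refl) (*ₗ-zeroˡ _))
                      (lincomb-zero (λ i → v (fsuc i)) (λ i → c≈0 (fsuc i))))
             (+ᴹ-identityˡ 0ᴹ)

  lincomb-+ : ∀ {n} {c d : Fin n → Carrier} (v : Fin n → Carrierᴹ) →
              lincomb V (λ i → c i + d i) v ≈ᴹ lincomb V c v +ᴹ lincomb V d v
  lincomb-+ {zero}  v = ≈ᴹ-sym (+ᴹ-identityˡ 0ᴹ)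
  lincomb-+ {suc n} v = ≈ᴹ-trans (+ᴹ-cong (*ₗ-distribʳ _ _ _) (lincomb-+ (λ i → v (fsuc i)))) (+ᴹ-interchange _ _ _ _)
    where open CommutativeSemigroupProperties (CommutativeMonoid.commutativeSemigroup +ᴹ-commutativeMonoid)
            using () renaming (interchange to +ᴹ-interchange)

  lincomb-*ₗ : ∀ {n} {c : Fin n → Carrier} (s : Carrier) (v : Fin n → Carrierᴹ) →
               lincomb V (λ i → s * c i) v ≈ᴹ s *ₗ lincomb V c v
  lincomb-*ₗ {zero}  s v = ≈ᴹ-sym (*ₗ-zeroʳ s)
  lincomb-*ₗ {suc n} s v =
    ≈ᴹ-trans (+ᴹ-cong (*ₗ-assoc _ _ _) (lincomb-*ₗ s (λ i → v (fsuc i)))) (≈ᴹ-sym (*ₗ-distribˡ _ _ _))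

  lincomb-supported₁ : ∀ {n} {c : Fin n → Carrier} (v : Fin n → Carrierᴹ) (j : Fin n) →
                       (∀ i → i ≢ j → c i ≈ 0#) → lincomb V c v ≈ᴹ c j *ₗ v j
  lincomb-supported₁ {suc n} {c} v fzero c≈0 = begin
    c fzero *ₗ v fzero +ᴹ lincomb V (λ i → c (fsuc i)) (λ i → v (fsuc i))
      ≈⟨ +ᴹ-congˡ (lincomb-zero (λ i → v (fsuc i)) (λ i → c≈0 (fsuc i) λ ())) ⟩
    c fzero *ₗ v fzero +ᴹ 0ᴹ ≈⟨ +ᴹ-identityʳ _ ⟩
    c fzero *ₗ v fzero       ∎
  lincomb-supported₁ {suc n} {c} v (fsuc j) c≈0 = begin
    c fzero *ₗ v fzero +ᴹ lincomb V (λ i → c (fsuc i)) (λ i → v (fsuc i))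
      ≈⟨ +ᴹ-cong (≈ᴹ-trans (*ₗ-cong (c≈0 fzero λ ()) ≈ᴹ-refl) (*ₗ-zeroˡ _))
                 (lincomb-supported₁ (λ i → v (fsuc i)) j λ i i≢j → c≈0 (fsuc i) (i≢j ∘ Fin.suc-injective)) ⟩
    0ᴹ +ᴹ c (fsuc j) *ₗ v (fsuc j) ≈⟨ +ᴹ-identityˡ _ ⟩
    c (fsuc j) *ₗ v (fsuc j)       ∎

  single : ∀ {n} → Fin n → Carrier → Fin n → Carrier
  single j s i with i ≟ j
  ... | yes _ = s
  ... | no  _ = 0#

  single-≡ : ∀ {n} (j : Fin n) (s : Carrier) → single j s j ≈ s
  single-≡ j s with j ≟ j
  ... | yes _   = refl
  ... | no  j≢j = contradiction ≡.refl j≢j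

  single-≢ : ∀ {n} {i j : Fin n} (s : Carrier) → i ≢ j → single j s i ≈ 0#
  single-≢ {i = i} {j} s i≢j with i ≟ j
  ... | yes i≡j = contradiction i≡j i≢j
  ... | no  _   = refl

  lincomb-single : ∀ {n} (v : Fin n → Carrierᴹ) (j : Fin n) (s : Carrier) → lincomb V (single j s) v ≈ᴹ s *ₗ v j
  lincomb-single v j s = ≈ᴹ-trans (lincomb-supported₁ v j (λ i → single-≢ s)) (*ₗ-cong (single-≡ j s) ≈ᴹ-refl)

  lincomb-+single : ∀ {n} (c : Fin n → Carrier) (v : Fin n → Carrierᴹ) (j : Fin n) (s : Carrier) →
                    lincomb V (λ i → c i + single j s i) v ≈ᴹ lincomb V c v +ᴹ s *ₗ v j
  lincomb-+single c v j s = ≈ᴹ-trans (lincomb-+ v) (+ᴹ-congˡ (lincomb-single v j s))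

  independent⇒+lincomb≉0 : ∀ {n} (v : Fin n → Carrierᴹ) → LinearlyIndependent V v → ¬ 1# ≈ 0# →
                           ∀ c i → c i ≈ 0# → ¬ v i +ᴹ lincomb V c v ≈ᴹ 0ᴹ
  independent⇒+lincomb≉0 v independent 1≉0 c i cᵢ≈0 vᵢ+c≈0 =
    1≉0 (trans (sym (trans (+-cong (single-≡ i 1#) cᵢ≈0) (+-identityʳ 1#)))
               (independent (λ j → single i 1# j + c j) combination≈0 i))
    where
      combination≈0 : lincomb V (λ j → single i 1# j + c j) v ≈ᴹ 0ᴹ
      combination≈0 = begin
        lincomb V (λ j → single i 1# j + c j) v ≈⟨ lincomb-+ v ⟩
        lincomb V (single i 1#) v +ᴹ lincomb V c v ≈⟨ +ᴹ-congʳ (≈ᴹ-trans (lincomb-single v i 1#) (*ₗ-identityˡ (v i))) ⟩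
        v i +ᴹ lincomb V c v ≈⟨ vᵢ+c≈0 ⟩
        0ᴹ ∎

  record IsLinearlyClosed {p} (P : Carrierᴹ → Set p) : Set (r ⊔ m ⊔ ℓm ⊔ p) where
    field
      ∈-resp-≈ᴹ : ∀ {x y} → x ≈ᴹ y → P x → P y
      0ᴹ∈       : P 0ᴹ
      +ᴹ∈       : ∀ {x y} → P x → P y → P (x +ᴹ y)
      *ₗ∈       : ∀ s {x} → P x → P (s *ₗ x)

    lincomb∈ : ∀ {n} {c : Fin n → Carrier} {v : Fin n → Carrierᴹ} →
               (∀ i → c i ≈ 0# ⊎ P (v i)) → P (lincomb V c v)
    lincomb∈ {zero}          _     = 0ᴹ∈
    lincomb∈ {suc n} {c} {v} cᵢ∈ = +ᴹ∈ head∈ (lincomb∈ (λ i → cᵢ∈ (fsuc i)))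
      where
        head∈ : P (c fzero *ₗ v fzero)
        head∈ with cᵢ∈ fzero
        ... | inj₁ c₀≈0 = ∈-resp-≈ᴹ (≈ᴹ-sym (≈ᴹ-trans (*ₗ-cong c₀≈0 ≈ᴹ-refl) (*ₗ-zeroˡ _))) 0ᴹ∈
        ... | inj₂ v₀∈  = *ₗ∈ (c fzero) v₀∈

    ∈-cancelʳ : ∀ {x y} → P (x +ᴹ y) → P y → P x
    ∈-cancelʳ {x} {y} x+y∈ y∈ = ∈-resp-≈ᴹ x+y-y≈x (+ᴹ∈ x+y∈ (*ₗ∈ (- 1#) y∈))
      where
        x+y-y≈x : (x +ᴹ y) +ᴹ (- 1#) *ₗ y ≈ᴹ x
        x+y-y≈x = begin
          (x +ᴹ y) +ᴹ (- 1#) *ₗ y        ≈⟨ +ᴹ-assoc x y _ ⟩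
          x +ᴹ (y +ᴹ (- 1#) *ₗ y)        ≈⟨ +ᴹ-congˡ (+ᴹ-congʳ (*ₗ-identityˡ y)) ⟨
          x +ᴹ (1# *ₗ y +ᴹ (- 1#) *ₗ y) ≈⟨ +ᴹ-congˡ (*ₗ-distribʳ y 1# (- 1#)) ⟨
          x +ᴹ (1# + - 1#) *ₗ y          ≈⟨ +ᴹ-congˡ (≈ᴹ-trans (*ₗ-cong (-‿inverseʳ 1#) ≈ᴹ-refl) (*ₗ-zeroˡ y)) ⟩
          x +ᴹ 0ᴹ                        ≈⟨ +ᴹ-identityʳ x ⟩
          x                              ∎

  InSpan : ∀ {n} → (Fin n → Carrierᴹ) → Carrierᴹ → Set (r ⊔ ℓm)
  InSpan v x = Σ[ c ∈ _ ] lincomb V c v ≈ᴹ x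

  span-isLinearlyClosed : ∀ {n} (v : Fin n → Carrierᴹ) → IsLinearlyClosed (InSpan v)
  span-isLinearlyClosed v = record
    { ∈-resp-≈ᴹ = λ { x≈y (c , c≈x) → c , ≈ᴹ-trans c≈x x≈y }
    ; 0ᴹ∈       = (λ _ → 0#) , lincomb-zero v (λ _ → refl)
    ; +ᴹ∈       = λ { (c , c≈x) (d , d≈y) → (λ i → c i + d i) , ≈ᴹ-trans (lincomb-+ v) (+ᴹ-cong c≈x d≈y) }
    ; *ₗ∈       = λ { s (c , c≈x) → (λ i → s * c i) , ≈ᴹ-trans (lincomb-*ₗ s v) (*ₗ-cong refl c≈x) }
    }

  vᵢ∈span : ∀ {n} (v : Fin n → Carrierᴹ) i → InSpan v (v i)
  vᵢ∈span v i = single i 1# , ≈ᴹ-trans (lincomb-single v i 1#) (*ₗ-identityˡ (v i))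

module BilinearForm {r ℓr m ℓm : Level} {K : CommutativeRing r ℓr} (V : Module K m ℓm)
  (ψ : Module.Carrierᴹ V → Module.Carrierᴹ V → CommutativeRing.Carrier K)
  (bilinear : IsSymmetricBilinear V ψ) where
  open CommutativeRing K
  open Module V
  open IsSymmetricBilinear bilinear renaming (cong to ψ-cong)
  open LinearCombinations V
  open SetoidReasoning setoid

  ψ-zeroˡ : ∀ w → ψ 0ᴹ w ≈ 0#
  ψ-zeroˡ w = begin
    ψ 0ᴹ w          ≈⟨ ψ-cong (*ₗ-zeroˡ 0ᴹ) ≈ᴹ-refl ⟨
    ψ (0# *ₗ 0ᴹ) w  ≈⟨ *-left 0# 0ᴹ w ⟩
    0# * ψ 0ᴹ w     ≈⟨ zeroˡ _ ⟩
    0#              ∎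

  ψ-lincomb-zero : ∀ {n} (c : Fin n → Carrier) (v : Fin n → Carrierᴹ) w →
                   (∀ i → c i * ψ (v i) w ≈ 0#) → ψ (lincomb V c v) w ≈ 0#
  ψ-lincomb-zero {zero}  c v w _     = ψ-zeroˡ w
  ψ-lincomb-zero {suc n} c v w terms≈0 = begin
    ψ (c fzero *ₗ v fzero +ᴹ lincomb V (λ i → c (fsuc i)) (λ i → v (fsuc i))) w ≈⟨ +-left _ _ w ⟩
    ψ (c fzero *ₗ v fzero) w + ψ (lincomb V (λ i → c (fsuc i)) (λ i → v (fsuc i))) w
      ≈⟨ +-cong (trans (*-left _ _ w) (terms≈0 fzero))
                (ψ-lincomb-zero (λ i → c (fsuc i)) (λ i → v (fsuc i)) w (λ i → terms≈0 (fsuc i))) ⟩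
    0# + 0# ≈⟨ +-identityʳ 0# ⟩
    0#      ∎

  ψ-lincomb-supported₁ : ∀ {n} (c : Fin n → Carrier) (v : Fin n → Carrierᴹ) w j →
                         (∀ i → i ≢ j → c i * ψ (v i) w ≈ 0#) → ψ (lincomb V c v) w ≈ c j * ψ (v j) w
  ψ-lincomb-supported₁ {suc n} c v w fzero terms≈0 = begin
    ψ (c fzero *ₗ v fzero +ᴹ lincomb V (λ i → c (fsuc i)) (λ i → v (fsuc i))) w ≈⟨ +-left _ _ w ⟩
    ψ (c fzero *ₗ v fzero) w + ψ (lincomb V (λ i → c (fsuc i)) (λ i → v (fsuc i))) w
      ≈⟨ +-cong (*-left _ _ w) (ψ-lincomb-zero (λ i → c (fsuc i)) (λ i → v (fsuc i)) w (λ i → terms≈0 (fsuc i) λ ())) ⟩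
    c fzero * ψ (v fzero) w + 0# ≈⟨ +-identityʳ _ ⟩
    c fzero * ψ (v fzero) w      ∎
  ψ-lincomb-supported₁ {suc n} c v w (fsuc j) terms≈0 = begin
    ψ (c fzero *ₗ v fzero +ᴹ lincomb V (λ i → c (fsuc i)) (λ i → v (fsuc i))) w ≈⟨ +-left _ _ w ⟩
    ψ (c fzero *ₗ v fzero) w + ψ (lincomb V (λ i → c (fsuc i)) (λ i → v (fsuc i))) w
      ≈⟨ +-cong (trans (*-left _ _ w) (terms≈0 fzero λ ()))
                (ψ-lincomb-supported₁ (λ i → c (fsuc i)) (λ i → v (fsuc i)) w j
                   λ i i≢j → terms≈0 (fsuc i) (i≢j ∘ Fin.suc-injective)) ⟩
    0# + c (fsuc j) * ψ (v (fsuc j)) w ≈⟨ +-identityˡ _ ⟩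
    c (fsuc j) * ψ (v (fsuc j)) w      ∎

  ψ-+*ₗˡ : ∀ y s w u → ψ (y +ᴹ s *ₗ w) u ≈ ψ y u + s * ψ w u
  ψ-+*ₗˡ y s w u = trans (+-left y (s *ₗ w) u) (+-congˡ (*-left s w u))

  ψ-+*ₗ-isotropic : ∀ y s w → ψ w w ≈ 0# →
                    ψ (y +ᴹ s *ₗ w) (y +ᴹ s *ₗ w) ≈ ψ y y + (1# + 1#) * (s * ψ y w)
  ψ-+*ₗ-isotropic y s w w-isotropic = begin
    ψ (y +ᴹ s *ₗ w) (y +ᴹ s *ₗ w)                 ≈⟨ ψ-+*ₗˡ y s w _ ⟩
    ψ y (y +ᴹ s *ₗ w) + s * ψ w (y +ᴹ s *ₗ w)     ≈⟨ +-cong (+-right y y _) (*-congˡ (+-right w y _)) ⟩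
    (ψ y y + ψ y (s *ₗ w)) + s * (ψ w y + ψ w (s *ₗ w))
      ≈⟨ +-cong (+-congˡ (*-right s y w))
                (*-congˡ (+-cong (symmetric w y) (trans (*-right s w w) (trans (*-congˡ w-isotropic) (zeroʳ s))))) ⟩
    (ψ y y + s * ψ y w) + s * (ψ y w + 0#)        ≈⟨ +-congˡ (*-congˡ (+-identityʳ _)) ⟩
    (ψ y y + s * ψ y w) + s * ψ y w               ≈⟨ +-assoc _ _ _ ⟩
    ψ y y + (s * ψ y w + s * ψ y w)               ≈⟨ +-congˡ (+-cong (*-identityˡ _) (*-identityˡ _)) ⟨
    ψ y y + (1# * (s * ψ y w) + 1# * (s * ψ y w)) ≈⟨ +-congˡ (distribʳ _ 1# 1#) ⟨
    ψ y y + (1# + 1#) * (s * ψ y w)               ∎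

  orthogonal-isLinearlyClosed : ∀ w → IsLinearlyClosed (λ x → ψ w x ≈ 0#)
  orthogonal-isLinearlyClosed w = record
    { ∈-resp-≈ᴹ = λ x≈y wx≈0 → trans (ψ-cong ≈ᴹ-refl (≈ᴹ-sym x≈y)) wx≈0
    ; 0ᴹ∈       = trans (symmetric w 0ᴹ) (ψ-zeroˡ w)
    ; +ᴹ∈       = λ wx≈0 wy≈0 → trans (+-right w _ _) (trans (+-cong wx≈0 wy≈0) (+-identityʳ 0#))
    ; *ₗ∈       = λ s wx≈0 → trans (*-right s w _) (trans (*-congˡ wx≈0) (zeroʳ s))
    }

  orthogonal-to-spanning⇒≈0 : ∀ {n} {v : Fin n → Carrierᴹ} → Spanning V v → Nondegenerate V ψ →
                             ∀ y → (∀ k → ψ y (v k) ≈ 0#) → y ≈ᴹ 0ᴹ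
  orthogonal-to-spanning⇒≈0 {v = v} spanning nondegenerate y y⊥v = nondegenerate y λ x →
    let (c , c≈x) = spanning x in begin
    ψ y x                ≈⟨ ψ-cong ≈ᴹ-refl c≈x ⟨
    ψ y (lincomb V c v)  ≈⟨ symmetric y _ ⟩
    ψ (lincomb V c v) y  ≈⟨ ψ-lincomb-zero c v y (λ k → trans (*-congˡ (trans (symmetric _ y) (y⊥v k))) (zeroʳ _)) ⟩
    0#                   ∎

  module _ (isField : IsField K) where
    open FieldProperties K isField

    dual-family⇒independent : ∀ {n} (v : Fin n → Carrierᴹ) (σ : Fin n → Fin n) →
      (∀ i j → i ≢ j → ψ (v i) (v (σ j)) ≈ 0#) → (∀ i → ¬ ψ (v i) (v (σ i)) ≈ 0#) →
      LinearlyIndependent V v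
    dual-family⇒independent v σ off-diagonal diagonal c c≈0 i =
      x*y≈0⇒x≈0 (diagonal i) (begin
        c i * ψ (v i) (v (σ i))     ≈⟨ ψ-lincomb-supported₁ c v (v (σ i)) i
                                         (λ j j≢i → trans (*-congˡ (off-diagonal j i j≢i)) (zeroʳ _)) ⟨
        ψ (lincomb V c v) (v (σ i)) ≈⟨ ψ-cong c≈0 ≈ᴹ-refl ⟩
        ψ 0ᴹ (v (σ i))              ≈⟨ ψ-zeroˡ _ ⟩
        0#                          ∎)

    private
      2*-comm-* : ∀ s a → (1# + 1#) * (s * a) ≈ s * ((1# + 1#) * a)
      2*-comm-* s a = trans (sym (*-assoc _ _ _)) (trans (*-congʳ (*-comm _ _)) (*-assoc _ _ _))

      2*≉0 : CharNot2 K → ∀ {a} → ¬ a ≈ 0# → ¬ (1# + 1#) * a ≈ 0#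
      2*≉0 char≢2 a≉0 2a≈0 = a≉0 (x*y≈0⇒x≈0 char≢2 (trans (*-comm _ _) 2a≈0))

    -- Along the line y + s w with w isotropic, ψ (y + s w) (y + s w) is affine in s
    -- with slope 2 ψ y w, so it has exactly one zero.
    isotropic-on-line : CharNot2 K → ∀ {y w} → ψ w w ≈ 0# → ¬ ψ y w ≈ 0# →
                        Σ[ s ∈ Carrier ] ψ (y +ᴹ s *ₗ w) (y +ᴹ s *ₗ w) ≈ 0#
    isotropic-on-line char≢2 {y} {w} w-isotropic yw≉0 = s , (begin
      ψ (y +ᴹ s *ₗ w) (y +ᴹ s *ₗ w)     ≈⟨ ψ-+*ₗ-isotropic y s w w-isotropic ⟩
      ψ y y + (1# + 1#) * (s * ψ y w)   ≈⟨ +-congˡ (2*-comm-* s _) ⟩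
      ψ y y + s * ((1# + 1#) * ψ y w)   ≈⟨ proj₂ s-solves ⟩
      0#                                ∎)
      where
        s-solves = solve-linear (2*≉0 char≢2 yw≉0) (ψ y y)
        s = proj₁ s-solves

    isotropic-on-line-unique : CharNot2 K → ∀ {y w s} → ψ w w ≈ 0# → ¬ ψ y w ≈ 0# → ψ y y ≈ 0# →
                               ψ (y +ᴹ s *ₗ w) (y +ᴹ s *ₗ w) ≈ 0# → s ≈ 0#
    isotropic-on-line-unique char≢2 {y} {w} {s} w-isotropic yw≉0 y-isotropic y+sw-isotropic =
      x*y≈0⇒x≈0 (2*≉0 char≢2 yw≉0) (begin
        s * ((1# + 1#) * ψ y w)         ≈⟨ 2*-comm-* s _ ⟨
        (1# + 1#) * (s * ψ y w)         ≈⟨ +-identityˡ _ ⟨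
        0# + (1# + 1#) * (s * ψ y w)    ≈⟨ +-congʳ y-isotropic ⟨
        ψ y y + (1# + 1#) * (s * ψ y w) ≈⟨ ψ-+*ₗ-isotropic y s w w-isotropic ⟨
        ψ (y +ᴹ s *ₗ w) (y +ᴹ s *ₗ w)   ≈⟨ y+sw-isotropic ⟩
        0#                              ∎)

module Lemma2p1 {r ℓr m ℓm : Level} (K : CommutativeRing r ℓr) (isField : IsField K) (char≢2 : CharNot2 K)
  (V : Module K m ℓm) (ψ : Module.Carrierᴹ V → Module.Carrierᴹ V → CommutativeRing.Carrier K)
  (bilinear : IsSymmetricBilinear V ψ) (nondegenerate : Nondegenerate V ψ)
  (g : ℕ) (b : Fin (suc (2 ℕ.* g)) → Module.Carrierᴹ V) (basis : IsBasis V b)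
  (gram-zero : ∀ i j → toℕ i ℕ.+ toℕ j ℕ.< 2 ℕ.* g → CommutativeRing._≈_ K (ψ (b i) (b j)) (CommutativeRing.0# K))
  where
  open CommutativeRing K
  open Module V
  open IsSymmetricBilinear bilinear renaming (cong to ψ-cong)
  open FieldProperties K isField
  open LinearCombinations V
  open BilinearForm V ψ bilinear
  open SetoidReasoning setoid

  2g : ℕ
  2g = 2 ℕ.* g

  Index : Set
  Index = Fin (suc 2g)

  G : Index → Index → Carrier
  G i j = ψ (b i) (b j)

  ψ-lincomb-below : ∀ {e : Index → Carrier} hi k → (∀ i → hi ℕ.≤ toℕ i → e i ≈ 0#) →
                    toℕ k ℕ.+ hi ℕ.≤ 2g → ψ (lincomb V e b) (b k) ≈ 0#
  ψ-lincomb-below {e} hi k e-support k+hi≤2g = ψ-lincomb-zero e b (b k) term≈0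
    where
      term≈0 : ∀ i → e i * G i k ≈ 0#
      term≈0 i with hi ℕ.≤? toℕ i
      ... | yes hi≤i = trans (*-congʳ (e-support i hi≤i)) (zeroˡ _)
      ... | no  hi≰i = trans (*-congˡ (gram-zero i k i+k<2g)) (zeroʳ _)
        where i+k<2g = ℕₚ.<-≤-trans (ℕₚ.+-monoˡ-< (toℕ k) (ℕₚ.≰⇒> hi≰i))
                                    (≡.subst (ℕ._≤ 2g) (ℕₚ.+-comm (toℕ k) hi) k+hi≤2g)

  OrthogonalOn : ℕ → ℕ → Carrierᴹ → Set ℓr
  OrthogonalOn lo hi y = ∀ j → lo ℕ.≤ toℕ j → toℕ j ℕ.< hi → ψ y (b (opposite j)) ≈ 0#

  -- The coefficients are fixed from the top index t = hi - 1 downwards: adding a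
  -- multiple of b t only changes ψ (_ , b k) for k ≥ opposite t, so the
  -- equations solved earlier stay solved.
  orthogonalise : ∀ lo hi → hi ℕ.≤ suc 2g →
                  (∀ j → lo ℕ.≤ toℕ j → toℕ j ℕ.< hi → ¬ G j (opposite j) ≈ 0#) →
                  ∀ v → Σ[ e ∈ (Index → Carrier) ]
                          (∀ i → toℕ i ℕ.< lo ⊎ hi ℕ.≤ toℕ i → e i ≈ 0#) × OrthogonalOn lo hi (v +ᴹ lincomb V e b)
  orthogonalise lo zero _ _ v = (λ _ → 0#) , (λ _ _ → refl) , λ _ _ ()
  orthogonalise lo (suc h) h<N nonzero v with lo ℕ.≤? h
  ... | no lo≰h =
    (λ _ → 0#) , (λ _ _ → refl) , λ j lo≤j j<1+h → contradiction (ℕₚ.≤-trans lo≤j (ℕₚ.≤-pred j<1+h)) lo≰h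
  ... | yes lo≤h = (λ i → single t s i + e i) , support , orthogonal
    where
      t : Index
      t = fromℕ< h<N
      toℕ-t : toℕ t ≡ h
      toℕ-t = Fin.toℕ-fromℕ< h<N
      s-solves = solve-linear (nonzero t (≡.subst (lo ℕ.≤_) (≡.sym toℕ-t) lo≤h) (ℕₚ.≤-reflexive (≡.cong suc toℕ-t)))
                              (ψ v (b (opposite t)))
      s = proj₁ s-solves
      v′ = v +ᴹ s *ₗ b t
      rec = orthogonalise lo h (ℕₚ.<⇒≤ h<N) (λ j lo≤j j<h → nonzero j lo≤j (ℕₚ.m<n⇒m<1+n j<h)) v′
      e = proj₁ rec
      e-support = proj₁ (proj₂ rec)
      y≈v′+e : v +ᴹ lincomb V (λ i → single t s i + e i) b ≈ᴹ v′ +ᴹ lincomb V e b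
      y≈v′+e = ≈ᴹ-trans (+ᴹ-congˡ (≈ᴹ-trans (lincomb-+ {c = single t s} {d = e} b) (+ᴹ-congʳ (lincomb-single b t s))))
                        (≈ᴹ-sym (+ᴹ-assoc _ _ _))
      ∉window⇒≢t : ∀ {i} → toℕ i ℕ.< lo ⊎ suc h ℕ.≤ toℕ i → i ≢ t
      ∉window⇒≢t (inj₁ t<lo) ≡.refl = ℕₚ.<⇒≱ t<lo (≡.subst (lo ℕ.≤_) (≡.sym toℕ-t) lo≤h)
      ∉window⇒≢t (inj₂ h<t)  ≡.refl = ℕₚ.<-irrefl (≡.sym toℕ-t) h<t
      support : ∀ i → toℕ i ℕ.< lo ⊎ suc h ℕ.≤ toℕ i → single t s i + e i ≈ 0#
      support i i∉ = trans (+-cong (single-≢ s (∉window⇒≢t i∉)) (e-support i (map₂ ℕₚ.<⇒≤ i∉))) (+-identityʳ 0#)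
      top-orthogonal : ψ (v′ +ᴹ lincomb V e b) (b (opposite t)) ≈ 0#
      top-orthogonal = begin
        ψ (v′ +ᴹ lincomb V e b) (b (opposite t))
          ≈⟨ +-left v′ _ _ ⟩
        ψ v′ (b (opposite t)) + ψ (lincomb V e b) (b (opposite t))
          ≈⟨ +-cong (ψ-+*ₗˡ v s (b t) _) (ψ-lincomb-below h (opposite t) (λ i h≤i → e-support i (inj₂ h≤i))
                                          (ℕₚ.≤-reflexive (≡.trans (≡.cong (toℕ (opposite t) ℕ.+_) (≡.sym toℕ-t)) (toℕ-opposite-+ t)))) ⟩
        (ψ v (b (opposite t)) + s * G t (opposite t)) + 0#
          ≈⟨ +-identityʳ _ ⟩
        ψ v (b (opposite t)) + s * G t (opposite t)
          ≈⟨ proj₂ s-solves ⟩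
        0# ∎
      orthogonal : OrthogonalOn lo (suc h) (v +ᴹ lincomb V (λ i → single t s i + e i) b)
      orthogonal j lo≤j j<1+h with ℕₚ.m≤n⇒m<n∨m≡n (ℕₚ.≤-pred j<1+h)
      ... | inj₁ j<h = trans (ψ-cong y≈v′+e ≈ᴹ-refl) (proj₂ (proj₂ rec) j lo≤j j<h)
      ... | inj₂ j≡h = trans (ψ-cong y≈v′+e ≈ᴹ-refl)
                              (≡.subst (λ j → ψ (v′ +ᴹ lincomb V e b) (b (opposite j)) ≈ 0#) t≡j top-orthogonal)
        where t≡j = Fin.toℕ-injective (≡.trans toℕ-t (≡.sym j≡h))

  antidiagonal-nonzero : ∀ i → ¬ G i (opposite i) ≈ 0#
  antidiagonal-nonzero = All.wfRec <-wellFounded _ (λ i → ¬ G i (opposite i) ≈ 0#) step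
    where
    step : ∀ i → (∀ {j} → toℕ j ℕ.< toℕ i → ¬ G j (opposite j) ≈ 0#) → ¬ G i (opposite i) ≈ 0#
    step i ih Gᵢᵢ′≈0 =
      independent⇒+lincomb≉0 b (proj₁ basis) (IsField.1≉0 isField) e i (e-support i (inj₂ ℕₚ.≤-refl))
        (orthogonal-to-spanning⇒≈0 (proj₂ basis) nondegenerate (b i +ᴹ lincomb V e b) y⊥b)
      where
        rec = orthogonalise 0 (toℕ i) (ℕₚ.<⇒≤ (Fin.toℕ<n i)) (λ j _ j<i → ih j<i) (b i)
        e = proj₁ rec
        e-support = proj₁ (proj₂ rec)
        Gᵢ-below : ∀ k → toℕ k ℕ.≤ toℕ (opposite i) → G i k ≈ 0#
        Gᵢ-below k k≤i′ with ℕₚ.m≤n⇒m<n∨m≡n k≤i′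
        ... | inj₁ k<i′ = gram-zero i k (ℕₚ.<-≤-trans (ℕₚ.+-monoʳ-< (toℕ i) k<i′)
                            (ℕₚ.≤-reflexive (≡.trans (ℕₚ.+-comm (toℕ i) _) (toℕ-opposite-+ i))))
        ... | inj₂ k≡i′ = ≡.subst (λ k → G i k ≈ 0#) (≡.sym (Fin.toℕ-injective k≡i′)) Gᵢᵢ′≈0
        y⊥b : ∀ k → ψ (b i +ᴹ lincomb V e b) (b k) ≈ 0#
        y⊥b k with toℕ k ℕ.≤? toℕ (opposite i)
        ... | yes k≤i′ = trans (+-left _ _ _)
                           (trans (+-cong (Gᵢ-below k k≤i′)
                                          (ψ-lincomb-below (toℕ i) k (λ m i≤m → e-support m (inj₂ i≤m))
                                             (ℕₚ.≤-trans (ℕₚ.+-monoˡ-≤ (toℕ i) k≤i′) (ℕₚ.≤-reflexive (toℕ-opposite-+ i)))))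
                                  (+-identityʳ 0#))
        ... | no  k≰i′ = ≡.subst (λ k → ψ (b i +ᴹ lincomb V e b) (b k) ≈ 0#) (Fin.opposite-involutive k)
                           (proj₂ (proj₂ rec) (opposite k) z≤n (opposite-<-swap (ℕₚ.≰⇒> k≰i′)))

  orthogonal⇒coefficients≈0 : ∀ lo hi (d : Index → Carrier) →
                              (∀ i → hi ℕ.≤ toℕ i → lo ℕ.≤ toℕ i → d i ≈ 0#) →
                              OrthogonalOn lo hi (lincomb V d b) → ∀ j → lo ℕ.≤ toℕ j → d j ≈ 0#
  orthogonal⇒coefficients≈0 lo zero    d d-above _          j lo≤j = d-above j z≤n lo≤j
  orthogonal⇒coefficients≈0 lo (suc h) d d-above orthogonal = orthogonal⇒coefficients≈0 lo h d d-above′ orthogonal′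
    where
      top≈0 : ∀ i → toℕ i ≡ h → lo ℕ.≤ toℕ i → d i ≈ 0#
      top≈0 i i≡h lo≤i = x*y≈0⇒x≈0 (antidiagonal-nonzero i) (begin
        d i * G i (opposite i)             ≈⟨ ψ-lincomb-supported₁ d b (b (opposite i)) i other-terms≈0 ⟨
        ψ (lincomb V d b) (b (opposite i)) ≈⟨ orthogonal i lo≤i (ℕₚ.≤-reflexive (≡.cong suc i≡h)) ⟩
        0#                                 ∎)
        where
          other-terms≈0 : ∀ k → k ≢ i → d k * G k (opposite i) ≈ 0#
          other-terms≈0 k k≢i with ℕₚ.<-cmp (toℕ k) (toℕ i)
          ... | tri< k<i _ _ = trans (*-congˡ (gram-zero k (opposite i) k+i′<2g)) (zeroʳ _)
            where k+i′<2g = ≡.subst (toℕ k ℕ.+ toℕ (opposite i) ℕ.<_)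
                                    (≡.trans (ℕₚ.+-comm (toℕ i) _) (toℕ-opposite-+ i))
                                    (ℕₚ.+-monoˡ-< (toℕ (opposite i)) k<i)
          ... | tri≈ _ k≡i _ = contradiction (Fin.toℕ-injective k≡i) k≢i
          ... | tri> _ _ i<k =
            trans (*-congʳ (d-above k (≡.subst (ℕ._< toℕ k) i≡h i<k) (ℕₚ.≤-trans lo≤i (ℕₚ.<⇒≤ i<k)))) (zeroˡ _)
      d-above′ : ∀ i → h ℕ.≤ toℕ i → lo ℕ.≤ toℕ i → d i ≈ 0#
      d-above′ i h≤i lo≤i with ℕₚ.m≤n⇒m<n∨m≡n h≤i
      ... | inj₁ h<i = d-above i h<i lo≤i
      ... | inj₂ h≡i = top≈0 i (≡.sym h≡i) lo≤i
      orthogonal′ : OrthogonalOn lo h (lincomb V d b)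
      orthogonal′ j lo≤j j<h = orthogonal j lo≤j (ℕₚ.m<n⇒m<1+n j<h)

  g+g≡2g : g ℕ.+ g ≡ 2g
  g+g≡2g = ≡.cong (g ℕ.+_) (≡.sym (ℕₚ.+-identityʳ g))

  outside⊎inner : ∀ (m t : Index) → ((toℕ m ℕ.+ toℕ t ℕ.< 2g) ⊎ (toℕ t ℕ.≤ toℕ m))
                                   ⊎ (2g ℕ.≤ toℕ m ℕ.+ toℕ t × toℕ m ℕ.< toℕ t)
  outside⊎inner m t with toℕ m ℕ.+ toℕ t ℕ.<? 2g | toℕ t ℕ.≤? toℕ m
  ... | yes m+t<2g | _       = inj₁ (inj₁ m+t<2g)
  ... | no  _      | yes t≤m = inj₁ (inj₂ t≤m)
  ... | no  m+t≮2g | no  t≰m = inj₂ (ℕₚ.≮⇒≥ m+t≮2g , ℕₚ.≰⇒> t≰m)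

  g<⇒2g<+ : ∀ {i j} → g ℕ.< i → g ℕ.< j → 2g ℕ.< i ℕ.+ j
  g<⇒2g<+ {i} {j} g<a g<b = ≡.subst (ℕ._< i ℕ.+ j) (g+g≡2g) (ℕₚ.+-mono-< g<a g<b)

  Shape : Index → Carrierᴹ → Set (r ⊔ ℓr ⊔ ℓm)
  Shape t x = Σ (Index → Carrier) (λ c →
                (∀ j → (toℕ j ℕ.+ toℕ t ℕ.< 2g) ⊎ (toℕ t ℕ.≤ toℕ j) → c j ≈ 0#)
                × (x ≈ᴹ (b t +ᴹ lincomb V c b)))

  shape-ψ-below : ∀ {t x} → Shape t x → ∀ k → toℕ k ℕ.+ toℕ t ℕ.≤ 2g → ψ x (b k) ≈ G t k
  shape-ψ-below {t} {x} (c , c-support , x≈) k k+t≤2g = begin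
    ψ x (b k)                                   ≈⟨ ψ-cong x≈ ≈ᴹ-refl ⟩
    ψ (b t +ᴹ lincomb V c b) (b k)              ≈⟨ +-left _ _ _ ⟩
    G t k + ψ (lincomb V c b) (b k)
      ≈⟨ +-congˡ (ψ-lincomb-below (toℕ t) k (λ j t≤j → c-support j (inj₂ t≤j)) k+t≤2g) ⟩
    G t k + 0#                                  ≈⟨ +-identityʳ _ ⟩
    G t k                                       ∎

  -- For g < t, the conditions of the lemma on p t, with (3) only imposed against
  -- b k for opposite t < k < t.
  IsCompletion : Index → Carrierᴹ → Set (r ⊔ ℓr ⊔ ℓm)
  IsCompletion t x = Shape t x × OrthogonalOn (suc (toℕ (opposite t))) (toℕ t) x × ψ x x ≈ 0#

  shape-resp-≈ᴹ : ∀ {t x y} → x ≈ᴹ y → Shape t x → Shape t y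
  shape-resp-≈ᴹ x≈y (c , c-support , x≈) = c , c-support , ≈ᴹ-trans (≈ᴹ-sym x≈y) x≈

  shape-difference : ∀ {t x x′} → Shape t x → Shape t x′ →
                     Σ[ d ∈ (Index → Carrier) ] (∀ j → (toℕ j ℕ.+ toℕ t ℕ.< 2g) ⊎ (toℕ t ℕ.≤ toℕ j) → d j ≈ 0#)
                                                × x ≈ᴹ x′ +ᴹ lincomb V d b
  shape-difference {t} {x} {x′} (c , c-support , x≈) (c′ , c′-support , x′≈) = d , d-outside , x≈x′+d
    where
      d : Index → Carrier
      d i = c i - c′ i
      d-outside : ∀ j → (toℕ j ℕ.+ toℕ t ℕ.< 2g) ⊎ (toℕ t ℕ.≤ toℕ j) → d j ≈ 0#
      d-outside j j∉ = trans (+-cong (c-support j j∉) (-‿cong (c′-support j j∉))) (-‿inverseʳ 0#)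
      c≈c′+d : ∀ i → c i ≈ c′ i + d i
      c≈c′+d i = sym (begin
        c′ i + (c i - c′ i)   ≈⟨ +-congˡ (+-comm (c i) _) ⟩
        c′ i + (- c′ i + c i) ≈⟨ +-assoc _ _ _ ⟨
        (c′ i - c′ i) + c i   ≈⟨ +-congʳ (-‿inverseʳ (c′ i)) ⟩
        0# + c i              ≈⟨ +-identityˡ (c i) ⟩
        c i                   ∎)
      x≈x′+d : x ≈ᴹ x′ +ᴹ lincomb V d b
      x≈x′+d = ≈ᴹ-trans x≈ (≈ᴹ-trans (+ᴹ-congˡ (≈ᴹ-trans (lincomb-cong b c≈c′+d) (lincomb-+ {c = c′} {d = d} b)))
                                      (≈ᴹ-trans (≈ᴹ-sym (+ᴹ-assoc _ _ _)) (+ᴹ-congʳ (≈ᴹ-sym x′≈))))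

  module _ (t : Index) (g<t : g ℕ.< toℕ t) where
    private
      l : Index
      l = opposite t

      l+t≡2g : toℕ l ℕ.+ toℕ t ≡ 2g
      l+t≡2g = toℕ-opposite-+ t

      l<t : toℕ l ℕ.< toℕ t
      l<t = ℕₚ.+-cancelʳ-< (toℕ t) _ _ (≡.subst (ℕ._< toℕ t ℕ.+ toℕ t) (≡.sym l+t≡2g) (g<⇒2g<+ g<t g<t))

      Gₗₗ≈0 : G l l ≈ 0#
      Gₗₗ≈0 = gram-zero l l (≡.subst (toℕ l ℕ.+ toℕ l ℕ.<_) l+t≡2g (ℕₚ.+-monoʳ-< (toℕ l) l<t))

      shape-ψ≉0 : ∀ {y} → Shape t y → ¬ ψ y (b l) ≈ 0#
      shape-ψ≉0 shape ψyl≈0 = antidiagonal-nonzero t (trans (sym (shape-ψ-below shape l (ℕₚ.≤-reflexive l+t≡2g))) ψyl≈0)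

      inner+*ₗbₗ-shape : ∀ e s → (∀ i → toℕ i ℕ.< suc (toℕ l) ⊎ toℕ t ℕ.≤ toℕ i → e i ≈ 0#) →
                         Shape t ((b t +ᴹ lincomb V e b) +ᴹ s *ₗ b l)
      inner+*ₗbₗ-shape e s e-support = (λ i → e i + single l s i) , c-support
                                     , ≈ᴹ-trans (+ᴹ-assoc _ _ _) (+ᴹ-congˡ (≈ᴹ-sym (lincomb-+single e b l s)))
        where
          below⇒<l : ∀ {j} → toℕ j ℕ.+ toℕ t ℕ.< 2g → toℕ j ℕ.< toℕ l
          below⇒<l {j} j+t<2g = ℕₚ.+-cancelʳ-< (toℕ t) _ _ (≡.subst (toℕ j ℕ.+ toℕ t ℕ.<_) (≡.sym l+t≡2g) j+t<2g)
          outside⇒≢l : ∀ {j} → (toℕ j ℕ.+ toℕ t ℕ.< 2g) ⊎ (toℕ t ℕ.≤ toℕ j) → j ≢ l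
          outside⇒≢l (inj₁ l+t<2g) ≡.refl = ℕₚ.<-irrefl ≡.refl (below⇒<l l+t<2g)
          outside⇒≢l (inj₂ t≤l)    ≡.refl = ℕₚ.<⇒≱ l<t t≤l
          c-support : ∀ j → (toℕ j ℕ.+ toℕ t ℕ.< 2g) ⊎ (toℕ t ℕ.≤ toℕ j) → e j + single l s j ≈ 0#
          c-support j j∉ = trans (+-cong (e-support j (map₁ (ℕₚ.m<n⇒m<1+n ∘ below⇒<l) j∉))
                                         (single-≢ s (outside⇒≢l j∉)))
                                 (+-identityʳ 0#)

    completion-exists : Σ Carrierᴹ (IsCompletion t)
    completion-exists = x , shape , x-orthogonal , proj₂ s-isotropic
      where
        rec = orthogonalise (suc (toℕ l)) (toℕ t) (ℕₚ.<⇒≤ (Fin.toℕ<n t)) (λ j _ _ → antidiagonal-nonzero j) (b t)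
        e = proj₁ rec
        y = b t +ᴹ lincomb V e b
        y+0≈y : y +ᴹ 0# *ₗ b l ≈ᴹ y
        y+0≈y = ≈ᴹ-trans (+ᴹ-congˡ (*ₗ-zeroˡ (b l))) (+ᴹ-identityʳ y)
        s-isotropic : Σ[ s ∈ Carrier ] ψ (y +ᴹ s *ₗ b l) (y +ᴹ s *ₗ b l) ≈ 0#
        s-isotropic = isotropic-on-line isField char≢2 Gₗₗ≈0
                        (shape-ψ≉0 (shape-resp-≈ᴹ y+0≈y (inner+*ₗbₗ-shape e 0# (proj₁ (proj₂ rec)))))
        s = proj₁ s-isotropic
        x = y +ᴹ s *ₗ b l
        shape : Shape t x
        shape = inner+*ₗbₗ-shape e s (proj₁ (proj₂ rec))
        x-orthogonal : OrthogonalOn (suc (toℕ l)) (toℕ t) x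
        x-orthogonal j l<j j<t = begin
          ψ x (b (opposite j))                        ≈⟨ ψ-+*ₗˡ y s (b l) _ ⟩
          ψ y (b (opposite j)) + s * G l (opposite j)
            ≈⟨ +-cong (proj₂ (proj₂ rec) j l<j j<t) (*-congˡ (gram-zero l (opposite j) l+j′<2g)) ⟩
          0# + s * 0#                                 ≈⟨ trans (+-identityˡ _) (zeroʳ s) ⟩
          0#                                          ∎
          where l+j′<2g = ≡.subst (toℕ l ℕ.+ toℕ (opposite j) ℕ.<_)
                            (≡.trans (ℕₚ.+-comm (toℕ j) _) (toℕ-opposite-+ j)) (ℕₚ.+-monoˡ-< (toℕ (opposite j)) l<j)

    completion-unique : ∀ {x x′} → IsCompletion t x → IsCompletion t x′ → x ≈ᴹ x′
    completion-unique {x} {x′} (shape , x-orthogonal , x-isotropic) (shape′ , x′-orthogonal , x′-isotropic) =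
      ≈ᴹ-trans x≈x′+d (≈ᴹ-trans (+ᴹ-congˡ (lincomb-zero b d≈0)) (+ᴹ-identityʳ x′))
      where
        difference = shape-difference shape shape′
        d = proj₁ difference
        d-outside = proj₁ (proj₂ difference)
        x≈x′+d = proj₂ (proj₂ difference)
        d-orthogonal : OrthogonalOn (suc (toℕ l)) (toℕ t) (lincomb V d b)
        d-orthogonal j l<j j<t = begin
          ψ (lincomb V d b) (b (opposite j))                        ≈⟨ +-identityˡ _ ⟨
          0# + ψ (lincomb V d b) (b (opposite j))                   ≈⟨ +-congʳ (x′-orthogonal j l<j j<t) ⟨
          ψ x′ (b (opposite j)) + ψ (lincomb V d b) (b (opposite j)) ≈⟨ +-left _ _ _ ⟨
          ψ (x′ +ᴹ lincomb V d b) (b (opposite j))                  ≈⟨ ψ-cong x≈x′+d ≈ᴹ-refl ⟨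
          ψ x (b (opposite j))                                      ≈⟨ x-orthogonal j l<j j<t ⟩
          0#                                                        ∎
        d≈0-off-l : ∀ j → j ≢ l → d j ≈ 0#
        d≈0-off-l j j≢l with ℕₚ.<-cmp (toℕ j) (toℕ l)
        ... | tri< j<l _ _ = d-outside j (inj₁ (≡.subst (toℕ j ℕ.+ toℕ t ℕ.<_) l+t≡2g (ℕₚ.+-monoˡ-< (toℕ t) j<l)))
        ... | tri≈ _ j≡l _ = contradiction (Fin.toℕ-injective j≡l) j≢l
        ... | tri> _ _ l<j = orthogonal⇒coefficients≈0 (suc (toℕ l)) (toℕ t) d (λ i t≤i _ → d-outside i (inj₂ t≤i))
                               d-orthogonal j l<j
        x≈x′+dₗbₗ : x ≈ᴹ x′ +ᴹ d l *ₗ b l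
        x≈x′+dₗbₗ = ≈ᴹ-trans x≈x′+d (+ᴹ-congˡ (lincomb-supported₁ b l d≈0-off-l))
        d≈0 : ∀ j → d j ≈ 0#
        d≈0 j with j ≟ l
        ... | yes ≡.refl = isotropic-on-line-unique isField char≢2 Gₗₗ≈0 (shape-ψ≉0 shape′) x′-isotropic
                             (trans (ψ-cong (≈ᴹ-sym x≈x′+dₗbₗ) (≈ᴹ-sym x≈x′+dₗbₗ)) x-isotropic)
        ... | no  j≢l    = d≈0-off-l j j≢l

  completion-orthogonal-below : ∀ {t x} → IsCompletion t x →
                                ∀ k → toℕ k ℕ.< toℕ t → toℕ k ℕ.+ toℕ t ≢ 2g → ψ x (b k) ≈ 0#
  completion-orthogonal-below {t} {x} (shape , orthogonal , _) k k<t k+t≢2g with ℕₚ.<-cmp (toℕ k ℕ.+ toℕ t) 2g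
  ... | tri< k+t<2g _ _ = trans (shape-ψ-below shape k (ℕₚ.<⇒≤ k+t<2g))
                                (gram-zero t k (≡.subst (ℕ._< 2g) (ℕₚ.+-comm (toℕ k) _) k+t<2g))
  ... | tri≈ _ k+t≡2g _ = contradiction k+t≡2g k+t≢2g
  ... | tri> _ _ 2g<k+t = ≡.subst (λ k → ψ x (b k) ≈ 0#) (Fin.opposite-involutive k)
                            (orthogonal (opposite k) (opposite-reverses-< k<t) (opposite-<-swap {i = t} (<+⇒opposite< {j = k} 2g<k+t)))

  shape∈ : ∀ {t x ℓ} {P : Carrierᴹ → Set ℓ} → IsLinearlyClosed P → Shape t x →
           P (b t) → (∀ m → 2g ℕ.≤ toℕ m ℕ.+ toℕ t → toℕ m ℕ.< toℕ t → P (b m)) → P x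
  shape∈ {t} {P = P} closed (c , c-support , x≈) bₜ∈ inner∈ =
    ∈-resp-≈ᴹ (≈ᴹ-sym x≈) (+ᴹ∈ bₜ∈ (lincomb∈ coefficient≈0⊎∈))
    where
      open IsLinearlyClosed closed
      coefficient≈0⊎∈ : ∀ m → c m ≈ 0# ⊎ P (b m)
      coefficient≈0⊎∈ m = map (c-support m) (λ (2g≤m+t , m<t) → inner∈ m 2g≤m+t m<t) (outside⊎inner m t)

  b∈linear-closure-of-q : ∀ {q} → Conditions V ψ g b q →
                          ∀ {ℓ} {P : Carrierᴹ → Set ℓ} → IsLinearlyClosed P → ∀ w →
              (∀ m → 2g ℕ.< toℕ m ℕ.+ w → toℕ m ℕ.< w → P (q m)) →
              ∀ k → 2g ℕ.< toℕ k ℕ.+ w → toℕ k ℕ.< w → P (b k)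
  b∈linear-closure-of-q {q} conditions {P = P} closed w q∈ =
    All.wfRec <-wellFounded _ (λ k → 2g ℕ.< toℕ k ℕ.+ w → toℕ k ℕ.< w → P (b k)) step
    where
      open IsLinearlyClosed closed
      open Conditions conditions
      step : ∀ k → (∀ {m} → toℕ m ℕ.< toℕ k → 2g ℕ.< toℕ m ℕ.+ w → toℕ m ℕ.< w → P (b m)) →
             2g ℕ.< toℕ k ℕ.+ w → toℕ k ℕ.< w → P (b k)
      step k ih 2g<k+w k<w with toℕ k ℕ.≤? g
      ... | yes k≤g = ∈-resp-≈ᴹ (cond1 k k≤g) (q∈ k 2g<k+w k<w)
      ... | no  k≰g with cond2 k (ℕₚ.≰⇒> k≰g)
      ...   | c , c-support , qₖ≈ = ∈-cancelʳ (∈-resp-≈ᴹ qₖ≈ (q∈ k 2g<k+w k<w)) (lincomb∈ coefficient≈0⊎∈)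
        where
          coefficient≈0⊎∈ : ∀ m → c m ≈ 0# ⊎ P (b m)
          coefficient≈0⊎∈ m = map (c-support m)
            (λ (2g≤m+k , m<k) → ih m<k (ℕₚ.≤-<-trans 2g≤m+k (ℕₚ.+-monoʳ-< (toℕ m) k<w)) (ℕₚ.<-trans m<k k<w))
            (outside⊎inner m k)

  p : Index → Carrierᴹ
  p i with ℕₚ.≤-<-connex (toℕ i) g
  ... | inj₁ _   = b i
  ... | inj₂ g<i = proj₁ (completion-exists i g<i)

  p-low : ∀ i → toℕ i ℕ.≤ g → p i ≈ᴹ b i
  p-low i i≤g with ℕₚ.≤-<-connex (toℕ i) g
  ... | inj₁ _   = ≈ᴹ-refl
  ... | inj₂ g<i = contradiction i≤g (ℕₚ.<⇒≱ g<i)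

  p-completion : ∀ i → g ℕ.< toℕ i → IsCompletion i (p i)
  p-completion i g<i with ℕₚ.≤-<-connex (toℕ i) g
  ... | inj₁ i≤g  = contradiction i≤g (ℕₚ.<⇒≱ g<i)
  ... | inj₂ g<i′ = proj₂ (completion-exists i g<i′)

  opposite≤g : ∀ i → g ℕ.< toℕ i → toℕ (opposite i) ℕ.≤ g
  opposite≤g i g<i = ℕₚ.<⇒≤ (+≡+⇒<⇒> (≡.trans g+g≡2g (≡.sym (toℕ-opposite-+ i))) g<i)

  p-orthogonal-below : ∀ i j → toℕ i ℕ.< toℕ j → toℕ i ℕ.+ toℕ j ≢ 2g → ψ (p j) (p i) ≈ 0#
  p-orthogonal-below i j i<j i+j≢2g = [ both-low , pᵢ⊥pⱼ ]′ (ℕₚ.≤-<-connex (toℕ j) g)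
    where
      both-low : toℕ j ℕ.≤ g → ψ (p j) (p i) ≈ 0#
      both-low j≤g = trans (ψ-cong (p-low j j≤g) (p-low i (ℕₚ.≤-trans (ℕₚ.<⇒≤ i<j) j≤g))) (gram-zero j i j+i<2g)
        where j+i<2g = ℕₚ.<-≤-trans (ℕₚ.+-monoʳ-< (toℕ j) i<j)
                         (ℕₚ.≤-trans (ℕₚ.+-mono-≤ j≤g j≤g) (ℕₚ.≤-reflexive (g+g≡2g)))
      pᵢ⊥pⱼ : g ℕ.< toℕ j → ψ (p j) (p i) ≈ 0#
      pᵢ⊥pⱼ g<j = [ (λ i≤g → ∈-resp-≈ᴹ (≈ᴹ-sym (p-low i i≤g)) (pⱼ⊥b i i<j i+j≢2g))
                  , (λ g<i → shape∈ closed (proj₁ (p-completion i g<i)) (pⱼ⊥b i i<j i+j≢2g) pⱼ⊥inner)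
                  ]′ (ℕₚ.≤-<-connex (toℕ i) g)
        where
          closed = orthogonal-isLinearlyClosed (p j)
          open IsLinearlyClosed closed
          pⱼ⊥b = completion-orthogonal-below (p-completion j g<j)
          pⱼ⊥inner : ∀ m → 2g ℕ.≤ toℕ m ℕ.+ toℕ i → toℕ m ℕ.< toℕ i → ψ (p j) (b m) ≈ 0#
          pⱼ⊥inner m 2g≤m+i m<i = pⱼ⊥b m (ℕₚ.<-trans m<i i<j)
            (λ m+j≡2g → ℕₚ.<-irrefl (≡.sym m+j≡2g) (ℕₚ.≤-<-trans 2g≤m+i (ℕₚ.+-monoʳ-< (toℕ m) i<j)))

  p-isotropic : ∀ i → toℕ i ℕ.+ toℕ i ≢ 2g → ψ (p i) (p i) ≈ 0#
  p-isotropic i i+i≢2g = [ low , (λ g<i → proj₂ (proj₂ (p-completion i g<i))) ]′ (ℕₚ.≤-<-connex (toℕ i) g)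
    where
      low : toℕ i ℕ.≤ g → ψ (p i) (p i) ≈ 0#
      low i≤g = trans (ψ-cong (p-low i i≤g) (p-low i i≤g)) (gram-zero i i (ℕₚ.≤∧≢⇒< i+i≤2g i+i≢2g))
        where i+i≤2g = ℕₚ.≤-trans (ℕₚ.+-mono-≤ i≤g i≤g) (ℕₚ.≤-reflexive (g+g≡2g))

  p-orthogonal : ∀ i j → toℕ i ℕ.+ toℕ j ≢ 2g → ψ (p i) (p j) ≈ 0#
  p-orthogonal i j i+j≢2g with ℕₚ.<-cmp (toℕ i) (toℕ j)
  ... | tri< i<j _ _ = trans (symmetric _ _) (p-orthogonal-below i j i<j i+j≢2g)
  ... | tri> _ _ j<i = p-orthogonal-below j i j<i (i+j≢2g ∘ ≡.trans (ℕₚ.+-comm (toℕ i) _))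
  ... | tri≈ _ i≡j _ with Fin.toℕ-injective i≡j
  ...   | ≡.refl = p-isotropic i i+j≢2g

  p-conditions : Conditions V ψ g b p
  p-conditions = record
    { cond1 = p-low
    ; cond2 = λ i g<i → proj₁ (p-completion i g<i)
    ; cond3 = p-orthogonal
    }

  ψ-p-antidiagonal : ∀ i → ψ (p i) (p (opposite i)) ≈ G i (opposite i)
  ψ-p-antidiagonal i = [ low , high ]′ (ℕₚ.≤-<-connex (toℕ i) g)
    where
      high : g ℕ.< toℕ i → ψ (p i) (p (opposite i)) ≈ G i (opposite i)
      high g<i = trans (ψ-cong ≈ᴹ-refl (p-low (opposite i) (opposite≤g i g<i)))
                       (shape-ψ-below (proj₁ (p-completion i g<i)) (opposite i) (ℕₚ.≤-reflexive (toℕ-opposite-+ i)))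
      low : toℕ i ℕ.≤ g → ψ (p i) (p (opposite i)) ≈ G i (opposite i)
      low i≤g = trans (ψ-cong (p-low i i≤g) ≈ᴹ-refl) ([ low-low , low-high ]′ (ℕₚ.≤-<-connex (toℕ (opposite i)) g))
        where
          low-low : toℕ (opposite i) ℕ.≤ g → ψ (b i) (p (opposite i)) ≈ G i (opposite i)
          low-low i′≤g = ψ-cong ≈ᴹ-refl (p-low (opposite i) i′≤g)
          low-high : g ℕ.< toℕ (opposite i) → ψ (b i) (p (opposite i)) ≈ G i (opposite i)
          low-high g<i′ = trans (symmetric _ _)
                                (trans (shape-ψ-below (proj₁ (p-completion (opposite i) g<i′)) i i+i′≤2g) (symmetric _ _))
            where i+i′≤2g = ℕₚ.≤-reflexive (≡.trans (ℕₚ.+-comm (toℕ i) _) (toℕ-opposite-+ i))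

  p-independent : LinearlyIndependent V p
  p-independent = dual-family⇒independent isField p opposite
    (λ i j i≢j → p-orthogonal i (opposite j)
                   (λ i+j′≡2g → i≢j (≡.trans (+≡⇒≡opposite i+j′≡2g) (Fin.opposite-involutive j))))
    (λ i pᵢ⊥pᵢ′ → antidiagonal-nonzero i (trans (sym (ψ-p-antidiagonal i)) pᵢ⊥pᵢ′))

  p-spanning : Spanning V p
  p-spanning x = ∈-resp-≈ᴹ c≈x (lincomb∈ {c = c} (λ k → inj₂ (bₖ∈span k)))
    where
      open IsLinearlyClosed (span-isLinearlyClosed p)
      c = proj₁ (proj₂ basis x)
      c≈x = proj₂ (proj₂ basis x)
      bₖ∈span : ∀ k → InSpan p (b k)
      bₖ∈span k = b∈linear-closure-of-q p-conditions (span-isLinearlyClosed p) (suc 2g) (λ m _ _ → vᵢ∈span p m)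
                            k (ℕₚ.m≤n+m (suc 2g) (toℕ k)) (Fin.toℕ<n k)

  conditions⇒completion : ∀ {q} → Conditions V ψ g b q → ∀ i → g ℕ.< toℕ i → IsCompletion i (q i)
  conditions⇒completion {q} conditions i g<i = cond2 i g<i , qᵢ-orthogonal , cond3 i i (2g<+⇒≢ (g<⇒2g<+ g<i g<i))
    where
      open Conditions conditions
      2g<+⇒≢ : ∀ {m} → 2g ℕ.< toℕ i ℕ.+ m → toℕ i ℕ.+ m ≢ 2g
      2g<+⇒≢ 2g<i+m i+m≡2g = ℕₚ.<-irrefl (≡.sym i+m≡2g) 2g<i+m
      qᵢ-orthogonal : OrthogonalOn (suc (toℕ (opposite i))) (toℕ i) (q i)
      qᵢ-orthogonal j i′<j j<i =
        b∈linear-closure-of-q conditions (orthogonal-isLinearlyClosed (q i)) (toℕ i)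
          (λ m 2g<m+i _ → cond3 i m (2g<+⇒≢ (≡.subst (2g ℕ.<_) (ℕₚ.+-comm (toℕ m) _) 2g<m+i)))
          (opposite j) (opposite<⇒<+ {j = opposite j} (opposite-reverses-< j<i)) (opposite-<-swap {i = i} i′<j)

  conditions⇒≈p : ∀ {q} → Conditions V ψ g b q → ∀ i → q i ≈ᴹ p i
  conditions⇒≈p conditions i =
    [ (λ i≤g → ≈ᴹ-trans (Conditions.cond1 conditions i i≤g) (≈ᴹ-sym (p-low i i≤g)))
    , (λ g<i → completion-unique i g<i (conditions⇒completion conditions i g<i) (p-completion i g<i))
    ]′ (ℕₚ.≤-<-connex (toℕ i) g)

lemma2p1 : {r ℓr m ℓm : Level} (K : CommutativeRing r ℓr) → IsField K → CharNot2 K →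
           (V : Module K m ℓm) →
           (ψ : Module.Carrierᴹ V → Module.Carrierᴹ V → CommutativeRing.Carrier K) →
           IsSymmetricBilinear V ψ → Nondegenerate V ψ →
           (g : ℕ) → 1 ℕ.≤ g →
           (b : Fin (suc (2 ℕ.* g)) → Module.Carrierᴹ V) → IsBasis V b →
           (∀ i j → toℕ i ℕ.+ toℕ j ℕ.< 2 ℕ.* g → CommutativeRing._≈_ K (ψ (b i) (b j)) (CommutativeRing.0# K)) →
           Σ (Fin (suc (2 ℕ.* g)) → Module.Carrierᴹ V) (λ p →
              (IsBasis V p × Conditions V ψ g b p)
              × (∀ (q : Fin (suc (2 ℕ.* g)) → Module.Carrierᴹ V) →
                   IsBasis V q → Conditions V ψ g b q → ∀ i → Module._≈ᴹ_ V (q i) (p i)))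
lemma2p1 K isField char≢2 V ψ bilinear nondegenerate g _ b basis gram-zero =
  p , ((p-independent , p-spanning) , p-conditions) , λ q _ → conditions⇒≈p
  where open Lemma2p1 K isField char≢2 V ψ bilinear nondegenerate g b basis gram-zero
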